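{- Let $k\geq 1$ and $m\geq 1$, and let $G$ be a graph that is $(k,1,1,\ldots,1)$-colourable (with $m$ colour classes of size $1$ in addition to one class of size $k$). Then $G$ is $1$-$11$-representable.
   Context: A graph is $(a_1,a_2,\ldots,a_n)$-colourable if it admits a proper colouring with $n$ colours but no proper colouring with $n-1$ colours, and the $i$-th colour class has size $a_i$. For a word $w$ over an alphabet $V$ and distinct letters $x,y$, let $w|_{\{x,y\}}$ denote the subword of $w$ obtained by deleting all letters other than $x$ and $y$. A graph $G=(V,E)$ is $1$-$11$-representable if there exists a word $w$ over the alphabet $V$ such that, for every pair of distinct vertices $x,y$, the word $w|_{\{x,y\}}$ contains in total at most one occurrence of the factors $xx$ and $yy$ if and only if $xy\in E$. -}

module Defs where

open import Data.Nat using (ℕ; zero; suc; _+_; _≤_)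
open import Data.Fin using (Fin; zero; suc; _≟_)
open import Data.Fin.Properties using () renaming (_≟_ to _≟F_)
open import Data.List using (List; []; _∷_; length; filter; allFin)
open import Data.Sum using (_⊎_)
open import Data.Product using (Σ; _×_; ∃)
open import Relation.Nullary using (¬_; Dec; yes; no)
open import Relation.Nullary.Decidable using (_⊎-dec_)
open import Relation.Binary using (Decidable)
open import Relation.Binary.PropositionalEquality using (_≡_; _≢_)
open import Function.Bundles using (_⇔_)

record Graph (n : ℕ) : Set₁ where
  field
    Adj    : Fin n → Fin n → Set
    adj?   : Decidable Adj
    sym    : ∀ {x y} → Adj x y → Adj y x
    irrefl : ∀ {x} → ¬ Adj x x

open Graph public

ProperColouring : ∀ {n} → Graph n → (c : ℕ) → (Fin n → Fin c) → Set
ProperColouring G c col = ∀ x y → Adj G x y → col x ≢ col y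

classSize : ∀ {n c} → (Fin n → Fin c) → Fin c → ℕ
classSize {n} col i = length (filter (λ x → col x ≟F i) (allFin n))

-- G is (a_1,...,a_c)-colourable: it has a proper colouring with c colours whose
-- i-th colour class has size a i, and no proper colouring with c - 1 colours.
-- (Stated for c = suc c' so that "c - 1" is c'.)
SizedColourable : ∀ {n} → Graph n → (c' : ℕ) → (Fin (suc c') → ℕ) → Set
SizedColourable {n} G c' a =
  (Σ (Fin n → Fin (suc c')) λ col →
     ProperColouring G (suc c') col × (∀ i → classSize col i ≡ a i))
  × (¬ Σ (Fin n → Fin c') λ col → ProperColouring G c' col)

k1s : (k m : ℕ) → Fin (suc m) → ℕ
k1s k m zero    = k
k1s k m (suc _) = 1

restrict : ∀ {n} → List (Fin n) → Fin n → Fin n → List (Fin n)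
restrict w x y = filter (λ z → (z ≟F x) ⊎-dec (z ≟F y)) w

-- number of occurrences of the factor xx in a word (overlapping occurrences counted)
countXXfrom : ∀ {n} → Fin n → Fin n → List (Fin n) → ℕ
countXXfrom x a []       = 0
countXXfrom x a (b ∷ rest) with a ≟F x | b ≟F x
... | yes _ | yes _ = suc (countXXfrom x b rest)
... | _     | _     = countXXfrom x b rest

countXX : ∀ {n} → Fin n → List (Fin n) → ℕ
countXX x []       = 0
countXX x (a ∷ rest) = countXXfrom x a rest

Rep1-11 : ∀ {n} → Graph n → Set
Rep1-11 {n} G = Σ (List (Fin n)) λ w →
  ∀ x y → x ≢ y →
    ((countXX x (restrict w x y) + countXX y (restrict w x y) ≤ 1) ⇔ Adj G x y)

{-# OPTIONS --safe #-}
module Submission where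

-- A proper (k,1,…,1)-colouring of a graph that is not m-colourable makes it a
-- split graph: the big class I is independent, and the singleton classes form a
-- clique C, since two non-adjacent singletons could share a colour.
--
-- A split graph is represented by a concatenation of arrangements of all
-- vertices.  Restricted to {x, y}, each arrangement becomes xy or yx, and the
-- squares xx, yy are exactly the switches between consecutive arrangements.
-- The opening arrangements (by index, reversed on I, by index) give every pair
-- in I two switches.  Then, for each index i, three arrangements interleave I
-- with C: an x ∈ I precedes the u ∈ C of index j in the phases before j and
-- follows it in those after, and in phase j the middle arrangement moves x in
-- front of u exactly when x and u are not adjacent, adding two switches.  Pairs
-- inside C never change order.

open import Defs hiding (sym)
open import Data.Bool using (Bool; true; false; not; if_then_else_; _xor_)
open import Data.Bool.Properties using (xor-same)
open import Data.Fin using (Fin; zero; suc; toℕ; fromℕ<; punchOut)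
open import Data.Fin.Properties
  using (toℕ<n; toℕ-injective; fromℕ<-toℕ; punchOut-injective)
  renaming (_≟_ to _≟ᶠ_)
open import Data.List using (List; []; _∷_; [_]; _++_; map; concatMap; filter; length; allFin)
open import Data.List.Extrema.Nat using (max; xs≤max)
open import Data.List.Membership.Propositional using (_∈_)
open import Data.List.Membership.Propositional.Properties using (∈-allFin; ∈-filter⁺; ∈-map⁺)
open import Data.List.Properties
  using (filter-++; filter-accept; filter-reject; filter-none; filter-≐; concatMap-++; ++-identityʳ)
open import Data.List.Relation.Unary.All as All using (All; []; _∷_)
open import Data.List.Relation.Unary.All.Properties using (all-filter) renaming (map⁺ to All-map⁺)
open import Data.List.Relation.Unary.AllPairs using ([]; _∷_)
open import Data.List.Relation.Unary.Any using (here)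
open import Data.List.Relation.Unary.Unique.Propositional using (Unique)
open import Data.List.Relation.Unary.Unique.Propositional.Properties using (allFin⁺)
import Data.List.Relation.Unary.Unique.Propositional.Properties as Unique
open import Data.Nat using (ℕ; zero; suc; _+_; _*_; _∸_; _≤_; _<_; z≤n; s≤s; z<s; _≟_; _<?_)
open import Data.Nat.Properties
open import Data.Product using (Σ; _×_; _,_; proj₁; proj₂)
open import Data.Sum using (_⊎_; inj₁; inj₂)
import Data.Sum as Sum
open import Function using (_∘_)
open import Function.Bundles using (_⇔_; mk⇔)
open import Level using (0ℓ)
open import Relation.Binary.Definitions using (tri<; tri≈; tri>)
open import Relation.Binary.PropositionalEquality
  using (_≡_; _≢_; refl; sym; trans; cong; cong₂; subst; subst₂; module ≡-Reasoning)
open import Relation.Nullary using (¬_; yes; no; does; contradiction)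
open import Relation.Nullary.Decidable using (_⊎-dec_; dec-true; dec-false)
open import Relation.Unary using (Pred; Decidable)

module _ {A : Set} where

  filter-comm : ∀ {P Q : Pred A 0ℓ} (P? : Decidable P) (Q? : Decidable Q) xs →
                filter P? (filter Q? xs) ≡ filter Q? (filter P? xs)
  filter-comm P? Q? [] = refl
  filter-comm P? Q? (x ∷ xs) with does (P? x) in p | does (Q? x) in q
  ... | true  | true  rewrite p | q = cong (x ∷_) (filter-comm P? Q? xs)
  ... | true  | false rewrite q     = filter-comm P? Q? xs
  ... | false | true  rewrite p     = filter-comm P? Q? xs
  ... | false | false               = filter-comm P? Q? xs

  ∈-length≤1 : ∀ {xs : List A} {a b} → length xs ≤ 1 → a ∈ xs → b ∈ xs → a ≡ b
  ∈-length≤1 {_ ∷ []}    _           (here refl) (here refl) = refl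
  ∈-length≤1 {_ ∷ _ ∷ _} (s≤s ())    _           _

  unique-pair : ∀ {xs : List A} {a b} → a ≢ b → Unique xs → All (λ z → z ≡ a ⊎ z ≡ b) xs →
                a ∈ xs → b ∈ xs → xs ≡ a ∷ b ∷ [] ⊎ xs ≡ b ∷ a ∷ []
  unique-pair {_ ∷ []} a≢b _ _ (here refl) (here refl) = contradiction refl a≢b
  unique-pair {_ ∷ _ ∷ []} _ ((c≢d ∷ []) ∷ _) (pc ∷ pd ∷ []) _ _ with pc | pd
  ... | inj₁ refl | inj₂ refl = inj₁ refl
  ... | inj₂ refl | inj₁ refl = inj₂ refl
  ... | inj₁ refl | inj₁ refl = contradiction refl c≢d
  ... | inj₂ refl | inj₂ refl = contradiction refl c≢d
  unique-pair {_ ∷ _ ∷ _ ∷ _} _ ((c≢d ∷ c≢e ∷ _) ∷ (d≢e ∷ _) ∷ _) (pc ∷ pd ∷ pe ∷ _) _ _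
    with pc | pd | pe
  ... | inj₁ refl | inj₁ refl | _         = contradiction refl c≢d
  ... | inj₂ refl | inj₂ refl | _         = contradiction refl c≢d
  ... | inj₁ refl | inj₂ refl | inj₁ refl = contradiction refl c≢e
  ... | inj₁ refl | inj₂ refl | inj₂ refl = contradiction refl d≢e
  ... | inj₂ refl | inj₁ refl | inj₁ refl = contradiction refl d≢e
  ... | inj₂ refl | inj₁ refl | inj₂ refl = contradiction refl c≢e

-- Bucket sort

module _ {A : Set} (κ : A → ℕ) where

  hasKey? : ∀ p → Decidable (λ a → κ a ≡ p)
  hasKey? p a = κ a ≟ p

  bucket : ℕ → List A → List A
  bucket p = filter (hasKey? p)

  bucketSort : ℕ → List A → List A
  bucketSort zero    xs = []
  bucketSort (suc K) xs = bucketSort K xs ++ bucket K xs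

  filter-bucketSort : ∀ {P : Pred A 0ℓ} (P? : Decidable P) K xs →
                      filter P? (bucketSort K xs) ≡ bucketSort K (filter P? xs)
  filter-bucketSort P? zero    xs = refl
  filter-bucketSort P? (suc K) xs = begin
    filter P? (bucketSort K xs ++ bucket K xs)
      ≡⟨ filter-++ P? (bucketSort K xs) (bucket K xs) ⟩
    filter P? (bucketSort K xs) ++ filter P? (bucket K xs)
      ≡⟨ cong₂ _++_ (filter-bucketSort P? K xs) (filter-comm P? (hasKey? K) xs) ⟩
    bucketSort K (filter P? xs) ++ bucket K (filter P? xs) ∎
    where open ≡-Reasoning

  bucketSort-cong : ∀ {K xs ys} → (∀ {p} → p < K → bucket p xs ≡ bucket p ys) →
                    bucketSort K xs ≡ bucketSort K ys
  bucketSort-cong {zero}  _  = refl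
  bucketSort-cong {suc K} eq = cong₂ _++_ (bucketSort-cong (eq ∘ m<n⇒m<1+n)) (eq (n<1+n K))

  bucketSort-[] : ∀ K → bucketSort K [] ≡ []
  bucketSort-[] zero    = refl
  bucketSort-[] (suc K) = trans (++-identityʳ _) (bucketSort-[] K)

  bucketSort-[_] : ∀ {K} a → κ a < K → bucketSort K [ a ] ≡ [ a ]
  bucketSort-[_] {suc K} a a<1+K with m<1+n⇒m<n∨m≡n a<1+K
  ... | inj₁ a<K = cong₂ _++_ (bucketSort-[ a ] a<K) (filter-reject (hasKey? K) (<⇒≢ a<K))
  ... | inj₂ a≡K = cong₂ _++_
    (trans (bucketSort-cong λ {p} p<K → filter-reject (hasKey? p) (>⇒≢ (subst (p <_) (sym a≡K) p<K)))
           (bucketSort-[] K))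
    (filter-accept (hasKey? K) a≡K)

  bucket-first : ∀ {p a b} → κ a ≡ p → κ b ≢ p → bucket p (a ∷ b ∷ []) ≡ [ a ]
  bucket-first {p} a≡p b≢p =
    trans (filter-accept (hasKey? p) a≡p) (cong (_ ∷_) (filter-reject (hasKey? p) b≢p))

  bucket-second : ∀ {p a b} → κ a ≢ p → κ b ≡ p → bucket p (a ∷ b ∷ []) ≡ [ b ]
  bucket-second {p} a≢p b≡p = trans (filter-reject (hasKey? p) a≢p) (filter-accept (hasKey? p) b≡p)

  bucketSort-pair : ∀ {K a b} → κ a < κ b → κ b < K → bucketSort K (a ∷ b ∷ []) ≡ a ∷ b ∷ []
  bucketSort-pair {suc K} {a} {b} a<b b<1+K with m<1+n⇒m<n∨m≡n b<1+K
  ... | inj₁ b<K = cong₂ _++_ (bucketSort-pair a<b b<K)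
                              (filter-none (hasKey? K) (<⇒≢ (<-trans a<b b<K) ∷ <⇒≢ b<K ∷ []))
  ... | inj₂ b≡K = cong₂ _++_ (trans (bucketSort-cong drop-b) (bucketSort-[ a ] a<K))
                              (bucket-second (<⇒≢ a<K) b≡K)
    where
    a<K : κ a < K
    a<K = subst (κ a <_) b≡K a<b
    b≢below : ∀ {p} → p < K → κ b ≢ p
    b≢below {p} p<K = >⇒≢ (subst (p <_) (sym b≡K) p<K)
    drop-b : ∀ {p} → p < K → bucket p (a ∷ b ∷ []) ≡ bucket p [ a ]
    drop-b {p} p<K with κ a ≟ p
    ... | yes a≡p = trans (bucket-first a≡p (b≢below p<K)) (sym (filter-accept (hasKey? p) a≡p))
    ... | no  a≢p =
      trans (filter-none (hasKey? p) (a≢p ∷ b≢below p<K ∷ [])) (sym (filter-reject (hasKey? p) a≢p))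

  bucketSort-swap : ∀ {K a b} → κ a ≢ κ b →
                    bucketSort K (a ∷ b ∷ []) ≡ bucketSort K (b ∷ a ∷ [])
  bucketSort-swap {K} {a} {b} κa≢κb = bucketSort-cong {K} λ {p} _ → swap p
    where
    swap : ∀ p → bucket p (a ∷ b ∷ []) ≡ bucket p (b ∷ a ∷ [])
    swap p with κ a ≟ p | κ b ≟ p
    ... | yes a≡p | yes b≡p = contradiction (trans a≡p (sym b≡p)) κa≢κb
    ... | yes a≡p | no  b≢p = trans (bucket-first a≡p b≢p) (sym (bucket-second b≢p a≡p))
    ... | no  a≢p | yes b≡p = trans (bucket-second a≢p b≡p) (sym (bucket-first b≡p a≢p))
    ... | no  a≢p | no  b≢p =
      trans (filter-none (hasKey? p) (a≢p ∷ b≢p ∷ []))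
            (sym (filter-none (hasKey? p) (b≢p ∷ a≢p ∷ [])))

-- Squares in words over two letters

changes : List Bool → ℕ
changes (b ∷ c ∷ bs) = (if b xor c then 1 else 0) + changes (c ∷ bs)
changes _            = 0

changes-const : ∀ {b bs} → All (_≡ b) bs → changes bs ≡ 0
changes-const []                      = refl
changes-const (_ ∷ [])                = refl
changes-const {b} {_ ∷ _ ∷ bs} (refl ∷ eqs@(refl ∷ _)) =
  trans (cong (λ c → (if c then 1 else 0) + changes (b ∷ bs)) (xor-same b)) (changes-const eqs)

module _ {n : ℕ} where

  inPair? : ∀ (x y : Fin n) → Decidable (λ z → z ≡ x ⊎ z ≡ y)
  inPair? x y z = (z ≟ᶠ x) ⊎-dec (z ≟ᶠ y)

  squares : Fin n → Fin n → List (Fin n) → ℕ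
  squares x y w = countXX x w + countXX y w

  pair : Fin n → Fin n → Bool → List (Fin n)
  pair x y b = (if b then x else y) ∷ (if b then y else x) ∷ []

  countXXfrom-hit : ∀ (z : Fin n) l → countXXfrom z z (z ∷ l) ≡ suc (countXXfrom z z l)
  countXXfrom-hit z l with z ≟ᶠ z
  ... | yes _   = refl
  ... | no z≢z = contradiction refl z≢z

  countXXfrom-miss : ∀ {z a : Fin n} b l → a ≢ z → countXXfrom z a (b ∷ l) ≡ countXXfrom z b l
  countXXfrom-miss {z} {a} b l a≢z with a ≟ᶠ z | b ≟ᶠ z
  ... | yes a≡z | _ = contradiction a≡z a≢z
  ... | no  _   | _ = refl

  countXXfrom-distinct : ∀ {z a b : Fin n} l → a ≢ b → countXXfrom z a (b ∷ l) ≡ countXXfrom z b l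
  countXXfrom-distinct {z} {a} {b} l a≢b with a ≟ᶠ z | b ≟ᶠ z
  ... | yes a≡z | yes b≡z = contradiction (trans a≡z (sym b≡z)) a≢b
  ... | yes _   | no  _   = refl
  ... | no  _   | _       = refl

  countXXfrom-++ : ∀ (z a : Fin n) l r → countXXfrom z a l ≤ countXXfrom z a (l ++ r)
  countXXfrom-++ z a []      r = z≤n
  countXXfrom-++ z a (b ∷ l) r with a ≟ᶠ z | b ≟ᶠ z
  ... | yes _ | yes _ = s≤s (countXXfrom-++ z b l r)
  ... | yes _ | no  _ = countXXfrom-++ z b l r
  ... | no  _ | _     = countXXfrom-++ z b l r

  squares-++ : ∀ x y l r → squares x y l ≤ squares x y (l ++ r)
  squares-++ x y []      r = z≤n
  squares-++ x y (a ∷ l) r = +-mono-≤ (countXXfrom-++ x a l r) (countXXfrom-++ y a l r)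

  module Alternation {x y : Fin n} (x≢y : x ≢ y) where

    private
      first second : Bool → Fin n
      first b  = if b then x else y
      second b = if b then y else x

      first≢second : ∀ b → first b ≢ second b
      first≢second true  = x≢y
      first≢second false = x≢y ∘ sym

      squaresFrom : Fin n → List (Fin n) → ℕ
      squaresFrom a l = countXXfrom x a l + countXXfrom y a l

      squaresFrom-distinct : ∀ {a b} l → a ≢ b → squaresFrom a (b ∷ l) ≡ squaresFrom b l
      squaresFrom-distinct l a≢b = cong₂ _+_ (countXXfrom-distinct l a≢b) (countXXfrom-distinct l a≢b)

      squaresFrom-repeat : ∀ b l → squaresFrom (first b) (first b ∷ l) ≡ suc (squaresFrom (first b) l)
      squaresFrom-repeat true  l = cong₂ _+_ (countXXfrom-hit x l) (countXXfrom-miss x l x≢y)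
      squaresFrom-repeat false l =
        trans (cong₂ _+_ (countXXfrom-miss y l (x≢y ∘ sym)) (countXXfrom-hit y l)) (+-suc _ _)

      -- the last letter of one block and the first of the next form a square iff the blocks differ
      squaresFrom-boundary : ∀ b c l →
        squaresFrom (second b) (first c ∷ l) ≡ (if b xor c then 1 else 0) + squaresFrom (first c) l
      squaresFrom-boundary true  true  l = squaresFrom-distinct l (x≢y ∘ sym)
      squaresFrom-boundary true  false l = squaresFrom-repeat false l
      squaresFrom-boundary false true  l = squaresFrom-repeat true l
      squaresFrom-boundary false false l = squaresFrom-distinct l x≢y

      squaresFrom-pairs : ∀ b bs → squaresFrom (second b) (concatMap (pair x y) bs) ≡ changes (b ∷ bs)
      squaresFrom-pairs b []       = refl
      squaresFrom-pairs b (c ∷ cs) = begin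
        squaresFrom (second b) (first c ∷ second c ∷ rest)
          ≡⟨ squaresFrom-boundary b c (second c ∷ rest) ⟩
        δ + squaresFrom (first c) (second c ∷ rest)
          ≡⟨ cong (δ +_) (squaresFrom-distinct rest (first≢second c)) ⟩
        δ + squaresFrom (second c) rest
          ≡⟨ cong (δ +_) (squaresFrom-pairs c cs) ⟩
        δ + changes (c ∷ cs) ∎
        where
        open ≡-Reasoning
        rest = concatMap (pair x y) cs
        δ = if b xor c then 1 else 0

    squares-pairs : ∀ bs → squares x y (concatMap (pair x y) bs) ≡ changes bs
    squares-pairs []       = refl
    squares-pairs (b ∷ bs) =
      trans (squaresFrom-distinct (concatMap (pair x y) bs) (first≢second b)) (squaresFrom-pairs b bs)

-- Words made of arrangements of all vertices

module _ {n : ℕ} where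

  restrict-comm : ∀ (w : List (Fin n)) x y → restrict w x y ≡ restrict w y x
  restrict-comm w x y = filter-≐ (inPair? x y) (inPair? y x) (Sum.swap , Sum.swap) w

  squares-comm : ∀ (w : List (Fin n)) x y → squares x y (restrict w x y) ≡ squares y x (restrict w y x)
  squares-comm w x y = trans (cong (squares x y) (restrict-comm w x y))
                             (+-comm (countXX x (restrict w y x)) (countXX y (restrict w y x)))

  restrict-allFin : ∀ {x y : Fin n} → x ≢ y →
    restrict (allFin n) x y ≡ x ∷ y ∷ [] ⊎ restrict (allFin n) x y ≡ y ∷ x ∷ []
  restrict-allFin {x} {y} x≢y =
    unique-pair x≢y (Unique.filter⁺ (inPair? x y) (allFin⁺ n)) (all-filter (inPair? x y) (allFin n))
                (∈-filter⁺ (inPair? x y) (∈-allFin x) (inj₁ refl))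
                (∈-filter⁺ (inPair? x y) (∈-allFin y) (inj₂ refl))

  keyBound : (Fin n → ℕ) → ℕ
  keyBound κ = suc (max 0 (map κ (allFin n)))

  key<keyBound : ∀ κ v → κ v < keyBound κ
  key<keyBound κ v = s≤s (All.lookup (xs≤max 0 (map κ (allFin n))) (∈-map⁺ κ (∈-allFin v)))

  arrange : (Fin n → ℕ) → List (Fin n)
  arrange κ = bucketSort κ (keyBound κ) (allFin n)

  restrict-arrange : ∀ {κ x y} → κ x < κ y → restrict (arrange κ) x y ≡ x ∷ y ∷ []
  restrict-arrange {κ} {x} {y} x<y =
    trans (filter-bucketSort κ (inPair? x y) (keyBound κ) (allFin n))
          (sort (restrict-allFin x≢y))
    where
    x≢y : x ≢ y
    x≢y refl = <-irrefl refl x<y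
    sort : ∀ {zs} → zs ≡ x ∷ y ∷ [] ⊎ zs ≡ y ∷ x ∷ [] →
           bucketSort κ (keyBound κ) zs ≡ x ∷ y ∷ []
    sort (inj₁ refl) = bucketSort-pair κ x<y (key<keyBound κ y)
    sort (inj₂ refl) = trans (bucketSort-swap κ (>⇒≢ x<y)) (bucketSort-pair κ x<y (key<keyBound κ y))

  restrict-arrange-≢ : ∀ {κ x y} → κ x ≢ κ y →
                       restrict (arrange κ) x y ≡ pair x y (does (κ x <? κ y))
  restrict-arrange-≢ {κ} {x} {y} κx≢κy with <-cmp (κ x) (κ y)
  ... | tri< x<y _ _ = trans (restrict-arrange x<y) (cong (pair x y) (sym (dec-true (κ x <? κ y) x<y)))
  ... | tri≈ _ κx≡κy _ = contradiction κx≡κy κx≢κy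
  ... | tri> _ _ y<x = begin
    restrict (arrange κ) x y          ≡⟨ restrict-comm (arrange κ) x y ⟩
    restrict (arrange κ) y x          ≡⟨ restrict-arrange y<x ⟩
    pair x y false                    ≡⟨ cong (pair x y) (dec-false (κ x <? κ y) (<-asym y<x)) ⟨
    pair x y (does (κ x <? κ y))      ∎
    where open ≡-Reasoning

module _ {n : ℕ} {T : Set} (key : T → Fin n → ℕ) where

  concatArrange : List T → List (Fin n)
  concatArrange = concatMap (arrange ∘ key)

  module _ {x y : Fin n} where

    restrict-concatArrange : ∀ {ts} → All (λ t → key t x ≢ key t y) ts →
      restrict (concatArrange ts) x y ≡ concatMap (pair x y) (map (λ t → does (key t x <? key t y)) ts)
    restrict-concatArrange []                  = refl
    restrict-concatArrange {t ∷ ts} (κ≢ ∷ κ≢s) =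
      trans (filter-++ (inPair? x y) (arrange (key t)) (concatArrange ts))
            (cong₂ _++_ (restrict-arrange-≢ κ≢) (restrict-concatArrange κ≢s))

    squares-concatArrange : x ≢ y → ∀ {ts} → All (λ t → key t x ≢ key t y) ts →
      squares x y (restrict (concatArrange ts) x y) ≡ changes (map (λ t → does (key t x <? key t y)) ts)
    squares-concatArrange x≢y {ts} κ≢s =
      trans (cong (squares x y) (restrict-concatArrange κ≢s))
            (Alternation.squares-pairs x≢y (map (λ t → does (key t x <? key t y)) ts))

    squares-concatArrange-++ : ∀ ts ts′ → squares x y (restrict (concatArrange ts) x y)
                                          ≤ squares x y (restrict (concatArrange (ts ++ ts′)) x y)
    squares-concatArrange-++ ts ts′ = begin
      squares x y (restrict w x y)
        ≤⟨ squares-++ x y (restrict w x y) (restrict w′ x y) ⟩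
      squares x y (restrict w x y ++ restrict w′ x y)
        ≡⟨ cong (squares x y) (filter-++ (inPair? x y) w w′) ⟨
      squares x y (restrict (w ++ w′) x y)
        ≡⟨ cong (λ v → squares x y (restrict v x y)) (concatMap-++ (arrange ∘ key) ts ts′) ⟨
      squares x y (restrict (concatArrange (ts ++ ts′)) x y) ∎
      where
      open ≤-Reasoning
      w  = concatArrange ts
      w′ = concatArrange ts′

-- Split graphs

data Round : Set where
  asc desc  : Round
  sep probe : ℕ → Round

opening : List Round
opening = asc ∷ desc ∷ asc ∷ []

phases : ℕ → ℕ → List Round
phases i zero    = []
phases i (suc c) = sep i ∷ probe i ∷ sep i ∷ phases (suc i) c

module _ {β : Round → Bool} {j : ℕ}
         (early : ∀ {i} → i < j → β (sep i) ≡ true × β (probe i) ≡ true)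
         (late  : ∀ {i} → j < i → β (sep i) ≡ false × β (probe i) ≡ false)
         (sep-j : β (sep j) ≡ false) where

  changes-late : ∀ {i} c → j < i → changes (false ∷ map β (phases i c)) ≡ 0
  changes-late zero    _   = refl
  changes-late (suc c) j<i rewrite proj₁ (late j<i) | proj₂ (late j<i) =
    changes-late c (m<n⇒m<1+n j<i)

  changes-phases : ∀ {i} c → i ≤ j → j < i + c →
                   changes (true ∷ map β (phases i c)) ≡ (if β (probe j) then 3 else 1)
  changes-phases {i} zero    i≤j j<i+0 =
    contradiction (subst (j <_) (+-identityʳ i) j<i+0) (≤⇒≯ i≤j)
  changes-phases {i} (suc c) i≤j j<i+1+c with m≤n⇒m<n∨m≡n i≤j
  ... | inj₁ i<j rewrite proj₁ (early i<j) | proj₂ (early i<j) =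
    changes-phases c i<j (subst (j <_) (+-suc i c) j<i+1+c)
  ... | inj₂ refl rewrite sep-j =
    spike (β (probe i)) (map β (phases (suc i) c)) (changes-late c (n<1+n i))
    where
    spike : ∀ b bs → changes (false ∷ bs) ≡ 0 →
            changes (true ∷ false ∷ b ∷ false ∷ bs) ≡ (if b then 3 else 1)
    spike true  _ eq = cong (3 +_) eq
    spike false _ eq = cong (1 +_) eq

even<odd : ∀ {a b} → a ≤ b → 2 * a < suc (2 * b)
even<odd a≤b = s≤s (*-monoʳ-≤ 2 a≤b)

odd<even : ∀ {a b} → a < b → suc (2 * a) < 2 * b
odd<even {a} {b} a<b = subst (_≤ 2 * b) (*-suc 2 a) (*-monoʳ-≤ 2 a<b)

module SplitWord {n} (G : Graph n) {I : Pred (Fin n) 0ℓ} (I? : Decidable I) where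

  adjacentTo : Fin n → ℕ → Bool
  adjacentTo x i with i <? n
  ... | yes i<n = does (adj? G x (fromℕ< i<n))
  ... | no  _   = false

  adjacentTo-toℕ : ∀ x u → adjacentTo x (toℕ u) ≡ does (adj? G x u)
  adjacentTo-toℕ x u with toℕ u <? n
  ... | yes u<n = cong (λ w → does (adj? G x w)) (fromℕ<-toℕ u u<n)
  ... | no  u≮n = contradiction (toℕ<n u) u≮n

  -- In the phases the clique vertex u has key 2u+1 and an independent vertex has
  -- key 2i+2 in phase i, just after the clique vertex of index i; in the probe
  -- round it drops to 2i, just before that vertex, if the two are not adjacent.
  probeKey : Bool → ℕ → ℕ
  probeKey true  i = 2 * suc i
  probeKey false i = 2 * i

  keyI keyC : Round → Fin n → ℕ
  keyI asc       x = toℕ x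
  keyI desc      x = n ∸ suc (toℕ x)
  keyI (sep i)   x = 2 * suc i
  keyI (probe i) x = probeKey (adjacentTo x i) i
  keyC asc       u = n + toℕ u
  keyC desc      u = n + toℕ u
  keyC (sep _)   u = suc (2 * toℕ u)
  keyC (probe _) u = suc (2 * toℕ u)

  key : Round → Fin n → ℕ
  key t v = if does (I? v) then keyI t v else keyC t v

  key-I : ∀ t {v} → I v → key t v ≡ keyI t v
  key-I t {v} v∈I = cong (λ b → if b then keyI t v else keyC t v) (dec-true (I? v) v∈I)

  key-C : ∀ t {v} → ¬ I v → key t v ≡ keyC t v
  key-C t {v} v∉I = cong (λ b → if b then keyI t v else keyC t v) (dec-false (I? v) v∉I)

  rounds : List Round
  rounds = opening ++ phases 0 n

  word : List (Fin n)
  word = concatArrange key rounds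

  probeKey-early : ∀ b {i j} → i < j → probeKey b i < suc (2 * j)
  probeKey-early true  i<j = even<odd i<j
  probeKey-early false i<j = even<odd (<⇒≤ i<j)

  probeKey-late : ∀ b {i j} → j < i → suc (2 * j) < probeKey b i
  probeKey-late true  j<i = odd<even (m<n⇒m<1+n j<i)
  probeKey-late false j<i = odd<even j<i

  probeKey≢odd : ∀ b i j → probeKey b i ≢ suc (2 * j)
  probeKey≢odd true  i = even≢odd (suc i)
  probeKey≢odd false i = even≢odd i

  keyI-desc<n : ∀ x → keyI desc x < n
  keyI-desc<n x = ∸-monoʳ-< z<s (toℕ<n x)

  keyI<keyC-asc : ∀ x u → keyI asc x < keyC asc u
  keyI<keyC-asc x u = <-≤-trans (toℕ<n x) (m≤m+n n (toℕ u))

  keyI<keyC-desc : ∀ x u → keyI desc x < keyC desc u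
  keyI<keyC-desc x u = <-≤-trans (keyI-desc<n x) (m≤m+n n (toℕ u))

  keyI≢keyC : ∀ t x u → keyI t x ≢ keyC t u
  keyI≢keyC asc       x u = <⇒≢ (keyI<keyC-asc x u)
  keyI≢keyC desc      x u = <⇒≢ (keyI<keyC-desc x u)
  keyI≢keyC (sep i)   x u = even≢odd (suc i) (toℕ u)
  keyI≢keyC (probe i) x u = probeKey≢odd (adjacentTo x i) i (toℕ u)

  keyC-mono : ∀ t {u v} → toℕ u < toℕ v → keyC t u < keyC t v
  keyC-mono asc       u<v = +-monoʳ-< n u<v
  keyC-mono desc      u<v = +-monoʳ-< n u<v
  keyC-mono (sep _)   u<v = s≤s (*-monoʳ-< 2 u<v)
  keyC-mono (probe _) u<v = s≤s (*-monoʳ-< 2 u<v)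

  module _ {x u : Fin n} (x∈I : I x) (u∉I : ¬ I u) where

    private
      j : ℕ
      j = toℕ u

      β : Round → Bool
      β t = does (key t x <? key t u)

      before : ∀ t → keyI t x < keyC t u → β t ≡ true
      before t lt = dec-true (key t x <? key t u) (subst₂ _<_ (sym (key-I t x∈I)) (sym (key-C t u∉I)) lt)

      after : ∀ t → keyC t u < keyI t x → β t ≡ false
      after t gt =
        dec-false (key t x <? key t u) (<-asym (subst₂ _<_ (sym (key-C t u∉I)) (sym (key-I t x∈I)) gt))

      probe-j : β (probe j) ≡ not (adjacentTo x j)
      probe-j = go (adjacentTo x j) refl
        where
        go : ∀ b → adjacentTo x j ≡ b → β (probe j) ≡ not b
        go true  eq =
          after (probe j) (subst (λ b → suc (2 * j) < probeKey b j) (sym eq) (odd<even (n<1+n j)))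
        go false eq =
          before (probe j) (subst (λ b → probeKey b j < suc (2 * j)) (sym eq) (even<odd (≤-refl {j})))

      keys-distinct : All (λ t → key t x ≢ key t u) rounds
      keys-distinct = All.universal (λ t →
        subst₂ _≢_ (sym (key-I t x∈I)) (sym (key-C t u∉I)) (keyI≢keyC t x u)) rounds

    squares-IC : squares x u (restrict word x u) ≡ (if not (does (adj? G x u)) then 3 else 1)
    squares-IC = begin
      squares x u (restrict word x u)
        ≡⟨ squares-concatArrange key (λ { refl → u∉I x∈I }) keys-distinct ⟩
      changes (β asc ∷ β desc ∷ β asc ∷ map β (phases 0 n))
        ≡⟨ cong₂ (λ a d → changes (a ∷ d ∷ a ∷ map β (phases 0 n)))
                 (before asc (keyI<keyC-asc x u)) (before desc (keyI<keyC-desc x u)) ⟩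
      changes (true ∷ map β (phases 0 n))
        ≡⟨ changes-phases early late (after (sep j) (odd<even (n<1+n j))) n z≤n (toℕ<n u) ⟩
      (if β (probe j) then 3 else 1)
        ≡⟨ cong (λ b → if b then 3 else 1) (trans probe-j (cong not (adjacentTo-toℕ x u))) ⟩
      (if not (does (adj? G x u)) then 3 else 1) ∎
      where
      open ≡-Reasoning
      early : ∀ {i} → i < j → β (sep i) ≡ true × β (probe i) ≡ true
      early {i} i<j = before (sep i) (even<odd i<j) , before (probe i) (probeKey-early (adjacentTo x i) i<j)
      late : ∀ {i} → j < i → β (sep i) ≡ false × β (probe i) ≡ false
      late {i} j<i =
        after (sep i) (odd<even (m<n⇒m<1+n j<i)) , after (probe i) (probeKey-late (adjacentTo x i) j<i)

  squares-CC : ∀ {u v} → ¬ I u → ¬ I v → toℕ u < toℕ v → squares u v (restrict word u v) ≡ 0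
  squares-CC {u} {v} u∉I v∉I u<v =
    trans (squares-concatArrange key u≢v {rounds} (All.universal (<⇒≢ ∘ ordered) rounds))
          (changes-const all-before)
    where
    u≢v : u ≢ v
    u≢v refl = <-irrefl refl u<v
    ordered : ∀ t → key t u < key t v
    ordered t = subst₂ _<_ (sym (key-C t u∉I)) (sym (key-C t v∉I)) (keyC-mono t u<v)
    all-before : All (_≡ true) (map (λ t → does (key t u <? key t v)) rounds)
    all-before =
      All-map⁺ {P = _≡ true} (All.universal (λ t → dec-true (key t u <? key t v) (ordered t)) rounds)

  squares-II : ∀ {x y} → I x → I y → toℕ x < toℕ y → 2 ≤ squares x y (restrict word x y)
  squares-II {x} {y} x∈I y∈I x<y = begin
    2
      ≡⟨ sym squares-opening ⟩
    squares x y (restrict (concatArrange key opening) x y)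
      ≤⟨ squares-concatArrange-++ key opening (phases 0 n) ⟩
    squares x y (restrict word x y) ∎
    where
    open ≤-Reasoning
    x≢y : x ≢ y
    x≢y refl = <-irrefl refl x<y
    asc-order : key asc x < key asc y
    asc-order = subst₂ _<_ (sym (key-I asc x∈I)) (sym (key-I asc y∈I)) x<y
    desc-order : key desc y < key desc x
    desc-order =
      subst₂ _<_ (sym (key-I desc y∈I)) (sym (key-I desc x∈I)) (∸-monoʳ-< (s≤s x<y) (toℕ<n y))
    squares-opening : squares x y (restrict (concatArrange key opening) x y) ≡ 2
    squares-opening =
      trans (squares-concatArrange key x≢y {opening}
               (<⇒≢ asc-order ∷ >⇒≢ desc-order ∷ <⇒≢ asc-order ∷ []))
            (cong₂ (λ a d → changes (a ∷ d ∷ a ∷ []))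
                   (dec-true (key asc x <? key asc y) asc-order)
                   (dec-false (key desc x <? key desc y) (<-asym desc-order)))

  Represented : Fin n → Fin n → Set
  Represented x y = (Adj G x y → squares x y (restrict word x y) ≤ 1)
                  × (¬ Adj G x y → 2 ≤ squares x y (restrict word x y))

  Represented-sym : ∀ {x y} → Represented x y → Represented y x
  Represented-sym {x} {y} (adj⇒≤1 , ¬adj⇒≥2) =
      (λ adj → subst (_≤ 1) (squares-comm word x y) (adj⇒≤1 (Graph.sym G adj)))
    , (λ ¬adj → subst (2 ≤_) (squares-comm word x y) (¬adj⇒≥2 (¬adj ∘ Graph.sym G)))

  Represented⇒⇔ : ∀ {x y} → Represented x y → (squares x y (restrict word x y) ≤ 1) ⇔ Adj G x y
  Represented⇒⇔ {x} {y} (adj⇒≤1 , ¬adj⇒≥2) = mk⇔ to adj⇒≤1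
    where
    to : squares x y (restrict word x y) ≤ 1 → Adj G x y
    to ≤1 with adj? G x y
    ... | yes adj = adj
    ... | no ¬adj = contradiction (¬adj⇒≥2 ¬adj) (≤⇒≯ ≤1)

  represented-IC : ∀ {x u} → I x → ¬ I u → Represented x u
  represented-IC {x} {u} x∈I u∉I with adj? G x u | squares-IC x∈I u∉I
  ... | yes adj  | eq = (λ _ → ≤-reflexive eq) , (λ ¬adj → contradiction adj ¬adj)
  ... | no  ¬adj | eq =
    (λ adj → contradiction adj ¬adj) , (λ _ → subst (2 ≤_) (sym eq) (s≤s (s≤s z≤n)))

split⇒Rep1-11 : ∀ {n} (G : Graph n) {I : Pred (Fin n) 0ℓ} → Decidable I →
                (∀ {x y} → I x → I y → ¬ Adj G x y) →
                (∀ {u v} → ¬ I u → ¬ I v → u ≢ v → Adj G u v) →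
                Rep1-11 G
split⇒Rep1-11 G {I} I? independent clique = word , λ x y x≢y → Represented⇒⇔ (represented x≢y)
  where
  open SplitWord G I?

  represented-II : ∀ {x y} → I x → I y → toℕ x < toℕ y → Represented x y
  represented-II x∈I y∈I x<y =
    (λ adj → contradiction adj (independent x∈I y∈I)) , (λ _ → squares-II x∈I y∈I x<y)

  represented-CC : ∀ {u v} → ¬ I u → ¬ I v → toℕ u < toℕ v → Represented u v
  represented-CC u∉I v∉I u<v =
      (λ _ → subst (_≤ 1) (sym (squares-CC u∉I v∉I u<v)) z≤n)
    , (λ ¬adj → contradiction (clique u∉I v∉I λ { refl → <-irrefl refl u<v }) ¬adj)

  represented : ∀ {x y} → x ≢ y → Represented x y
  represented {x} {y} x≢y with I? x | I? y | <-cmp (toℕ x) (toℕ y)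
  ... | _       | _       | tri≈ _ x≡y _ = contradiction (toℕ-injective x≡y) x≢y
  ... | yes x∈I | yes y∈I | tri< x<y _ _ = represented-II x∈I y∈I x<y
  ... | yes x∈I | yes y∈I | tri> _ _ y<x = Represented-sym (represented-II y∈I x∈I y<x)
  ... | yes x∈I | no  y∉I | _            = represented-IC x∈I y∉I
  ... | no  x∉I | yes y∈I | _            = Represented-sym (represented-IC y∈I x∉I)
  ... | no  x∉I | no  y∉I | tri< x<y _ _ = represented-CC x∉I y∉I x<y
  ... | no  x∉I | no  y∉I | tri> _ _ y<x = Represented-sym (represented-CC y∉I x∉I y<x)

-- Colourings

classSize≡1⇒≡ : ∀ {n c} {col : Fin n → Fin c} {i a b} →
                classSize col i ≡ 1 → col a ≡ i → col b ≡ i → a ≡ b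
classSize≡1⇒≡ {col = col} {i} {a} {b} size≡1 a∈i b∈i =
  ∈-length≤1 (≤-reflexive size≡1) (∈-filter⁺ (λ v → col v ≟ᶠ i) (∈-allFin a) a∈i)
                                  (∈-filter⁺ (λ v → col v ≟ᶠ i) (∈-allFin b) b∈i)

module _ {n c : ℕ} (G : Graph n) where

  mergeColours : ∀ {col : Fin n → Fin (suc c)} {i j : Fin (suc c)} →
                 ProperColouring G (suc c) col → i ≢ j →
                 (∀ {a b} → col a ≡ i → col b ≡ j → ¬ Adj G a b) →
                 Σ (Fin n → Fin c) (ProperColouring G c)
  mergeColours {col} {i} {j} proper i≢j no-edge = merged , merged-proper
    where
    recolour : Fin (suc c) → Fin (suc c)
    recolour k with k ≟ᶠ j
    ... | yes _ = i
    ... | no  _ = k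

    recolour-spec : ∀ k → (k ≡ j × recolour k ≡ i) ⊎ (k ≢ j × recolour k ≡ k)
    recolour-spec k with k ≟ᶠ j
    ... | yes k≡j = inj₁ (k≡j , refl)
    ... | no  k≢j = inj₂ (k≢j , refl)

    j≢recolour : ∀ k → j ≢ recolour k
    j≢recolour k with recolour-spec k
    ... | inj₁ (_   , r≡i) = λ j≡r → i≢j (sym (trans j≡r r≡i))
    ... | inj₂ (k≢j , r≡k) = λ j≡r → k≢j (sym (trans j≡r r≡k))

    merged : Fin n → Fin c
    merged v = punchOut (j≢recolour (col v))

    merged-proper : ProperColouring G c merged
    merged-proper a b adj eq
      with recolour-spec (col a) | recolour-spec (col b)
         | punchOut-injective (j≢recolour (col a)) (j≢recolour (col b)) eq
    ... | inj₁ (a≡j , _)   | inj₁ (b≡j , _)   | _  =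
      proper a b adj (trans a≡j (sym b≡j))
    ... | inj₁ (a≡j , a↦i) | inj₂ (_ , b↦b)   | r≡ =
      no-edge (trans (sym b↦b) (trans (sym r≡) a↦i)) a≡j (Graph.sym G adj)
    ... | inj₂ (_ , a↦a)   | inj₁ (b≡j , b↦i) | r≡ =
      no-edge (trans (sym a↦a) (trans r≡ b↦i)) b≡j adj
    ... | inj₂ (_ , a↦a)   | inj₂ (_ , b↦b)   | r≡ =
      proper a b adj (trans (sym a↦a) (trans r≡ b↦b))

  singletons-adjacent : ∀ {col : Fin n → Fin (suc c)} → ProperColouring G (suc c) col →
                        ¬ Σ (Fin n → Fin c) (ProperColouring G c) →
                        ∀ {u v} → classSize col (col u) ≡ 1 → classSize col (col v) ≡ 1 → u ≢ v →
                        Adj G u v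
  singletons-adjacent {col} proper not-c-colourable {u} {v} size-u size-v u≢v with adj? G u v
  ... | yes adj  = adj
  ... | no  ¬adj = contradiction (mergeColours proper cu≢cv no-edge) not-c-colourable
    where
    cu≢cv : col u ≢ col v
    cu≢cv cu≡cv = u≢v (classSize≡1⇒≡ size-u refl (sym cu≡cv))
    no-edge : ∀ {a b} → col a ≡ col u → col b ≡ col v → ¬ Adj G a b
    no-edge a∈u b∈v =
      ¬adj ∘ subst₂ (Adj G) (classSize≡1⇒≡ size-u a∈u refl) (classSize≡1⇒≡ size-v b∈v refl)

k1s-suc : ∀ {k m} {i : Fin (suc m)} → i ≢ zero → k1s k m i ≡ 1
k1s-suc {i = zero}  i≢0 = contradiction refl i≢0
k1s-suc {i = suc _} _   = refl

lemma7 : (k m : ℕ) → 1 ≤ k → 1 ≤ m → (G : Graph (k + m)) →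
    SizedColourable G m (k1s k m) → Rep1-11 G
lemma7 k m _ _ G ((col , proper , sizes) , not-m-colourable) =
  split⇒Rep1-11 G (λ v → col v ≟ᶠ zero)
    (λ {x} {y} x∈0 y∈0 adj → proper x y adj (trans x∈0 (sym y∈0)))
    (λ u∉0 v∉0 → singletons-adjacent G proper not-m-colourable (size-1 u∉0) (size-1 v∉0))
  where
  size-1 : ∀ {v} → col v ≢ zero → classSize col (col v) ≡ 1
  size-1 {v} v∉0 = trans (sizes (col v)) (k1s-suc v∉0)
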